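{- Let $m \geq 3$ and $n \geq 2$, and let $G$ be either $P_n \times K_m$ or $C_n \times K_m$. Let $D$ be a dominating set of $G$ and for $i\in[n]$ let $d_i = |D \cap X_i|$, where $X_i=\{(i,j): j\in[m]\}$. Then $d_{i-1}+d_i+d_{i+1} \geq 2$ for every $1 \le i \le n$, with the conventions $d_0=d_{n+1}=0$ when $G=P_n\times K_m$, and $d_0=d_n$, $d_{n+1}=d_1$ when $G=C_n\times K_m$.
   Context: $[n]=\{1,\dots,n\}$. $P_n$ is the path on $[n]$ with edges $\{i,i+1\}$; $C_n$ is the cycle on $[n]$ with edges $\{i,i+1\}$ and $\{n,1\}$ ($C_2$ is understood as the single edge $\{1,2\}$); $K_m$ is the complete graph on $[m]$. The direct product $G\times H$ has vertex set $V(G)\times V(H)$ with $(g_1,h_1)\sim(g_2,h_2)$ iff $g_1g_2\in E(G)$ and $h_1h_2\in E(H)$; thus in $P_n\times K_m$, $(i,j)\sim(i',j')$ iff $|i-i'|=1$ and $j\ne j'$, and $C_n\times K_m$ additionally has the edges between $(1,j)$ and $(n,j')$ for $j\neq j'$. The set $X_i$ is called the $i$-th column. A dominating set is a set $D$ of vertices such that every vertex not in $D$ is adjacent to a vertex of $D$. -}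

module Defs where

open import Data.Nat using (ℕ; zero; suc; _+_; _≤_; _<_; _≥_; _≟_)
open import Data.Fin using (Fin; toℕ; fromℕ<)
open import Data.Fin.Subset using (Subset; _∈_; _∉_; ∣_∣)
open import Data.Product using (_×_; Σ; ∃; _,_)
open import Data.Sum using (_⊎_)
open import Data.Nat.Properties using (_<?_)
open import Relation.Nullary using (¬_; yes; no)
open import Relation.Binary.PropositionalEquality using (_≡_)

data Kind : Set where
  path cycle : Kind

-- Columns are indexed by Fin n (column i ∈ [n] is  Fin index i-1),
-- rows (the K_m coordinate) by Fin m.

PathAdj : ∀ {n} → Fin n → Fin n → Set
PathAdj i i' = (suc (toℕ i) ≡ toℕ i') ⊎ (suc (toℕ i') ≡ toℕ i)

-- Adjacency of columns in C_n: path edges plus the edge {1,n}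
-- (for n = 2 this is again the single edge {1,2}).
CycleAdj : ∀ {n} → Fin n → Fin n → Set
CycleAdj {n} i i' =
  PathAdj i i' ⊎ ((toℕ i ≡ 0 × suc (toℕ i') ≡ n) ⊎ (toℕ i' ≡ 0 × suc (toℕ i) ≡ n))

ColAdj : Kind → ∀ {n} → Fin n → Fin n → Set
ColAdj path   = PathAdj
ColAdj cycle  = CycleAdj

Adj : Kind → ∀ {n m} → Fin n × Fin m → Fin n × Fin m → Set
Adj k (i , j) (i' , j') = ColAdj k i i' × ¬ (j ≡ j')

-- A vertex set D is given by its columns: D i ⊆ Fin m is D ∩ X_i.
VSet : ℕ → ℕ → Set
VSet n m = Fin n → Subset m

_∈V_ : ∀ {n m} → Fin n × Fin m → VSet n m → Set
(i , j) ∈V D = j ∈ D i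

Dominating : Kind → ∀ {n m} → VSet n m → Set
Dominating k {n} {m} D =
  ∀ (v : Fin n × Fin m) → ¬ (v ∈V D) →
    Σ (Fin n × Fin m) λ u → (u ∈V D) × Adj k u v

-- d_i = |D ∩ X_i| for i ∈ [n] (1-based), extended by the conventions:
-- path:  d_0 = d_{n+1} = 0;   cycle: d_0 = d_n, d_{n+1} = d_1.
-- Only the values at 0 … n+1 are ever used.
dcol : ∀ {n m} → VSet n m → ℕ → ℕ
dcol {n} D zero = 0
dcol {n} D (suc i) with i <? n
... | yes p = ∣ D (fromℕ< p) ∣
... | no _  = 0

d : Kind → ∀ {n m} → VSet n m → ℕ → ℕ
d path        D i = dcol D i
d cycle {n}   D zero = dcol D n
d cycle {n}   D (suc i) with suc i ≟ suc n
... | yes _ = dcol D 1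
... | no _  = dcol D (suc i)

-- If X_i contains two vertices of D we are done. Otherwise some (i , j) ∉ D; it is
-- dominated by some (i' , j') ∈ D with i' a neighbouring column and j' ≠ j. If
-- (i , j') ∈ D, then X_i and X_i' each meet D. If not, (i , j') needs a dominator
-- of its own, and it cannot be (i' , j'), which lies in the same row. So either X_i'
-- contains two vertices of D, or both neighbouring columns meet D. A neighbouring
-- column is counted as d_{i-1} or as d_{i+1}, and two distinct neighbouring columns
-- cannot fill the same slot.
{-# OPTIONS --safe #-}
module Submission where

open import Defs
open import Data.Nat using (ℕ; suc; _+_; _∸_; _≤_; _≥_; _<_; z≤n; s≤s; _≟_)
open import Data.Nat.Properties using (_<?_; ≤-trans; +-mono-≤; n≤1+n; suc-injective; <⇒≢)
open import Data.Fin using (Fin; toℕ; fromℕ<) renaming (zero to fzero; suc to fsuc)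
open import Data.Fin.Properties using (toℕ-injective; toℕ<n; fromℕ<-toℕ; toℕ-fromℕ<)
  renaming (_≟_ to _≟ᶠ_)
open import Data.Fin.Subset using (Subset; _∈_; _∉_; ∣_∣)
open import Data.Fin.Subset.Properties using (_∈?_; x∈p⇒∣p-x∣<∣p∣; x∈p∧x≢y⇒x∈p-y)
open import Data.Product using (_×_; _,_)
open import Data.Sum using (_⊎_; inj₁; inj₂)
open import Function using (_∘_)
open import Relation.Nullary using (yes; no; contradiction)
open import Relation.Binary.PropositionalEquality using (_≡_; _≢_; refl; sym; trans; cong; subst)

x∈p⇒0<∣p∣ : ∀ {n} {x : Fin n} {p : Subset n} → x ∈ p → 0 < ∣ p ∣
x∈p⇒0<∣p∣ x∈p = ≤-trans (s≤s z≤n) (x∈p⇒∣p-x∣<∣p∣ x∈p)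

x∈p∧y∈p∧x≢y⇒1<∣p∣ : ∀ {n} {x y : Fin n} {p : Subset n} →
                     x ∈ p → y ∈ p → x ≢ y → 1 < ∣ p ∣
x∈p∧y∈p∧x≢y⇒1<∣p∣ x∈p y∈p x≢y =
  ≤-trans (s≤s (x∈p⇒0<∣p∣ (x∈p∧x≢y⇒x∈p-y y∈p (x≢y ∘ sym)))) (x∈p⇒∣p-x∣<∣p∣ x∈p)

infix 4 _⋖_
_⋖_ : ∀ {n} → Fin n → Fin n → Set
_⋖_ {n} c' c = suc (toℕ c') ≡ toℕ c ⊎ (toℕ c ≡ 0 × suc (toℕ c') ≡ n)

⋖-predecessor-unique : ∀ {n} {c c' c'' : Fin n} → c' ⋖ c → c'' ⋖ c → c' ≡ c''
⋖-predecessor-unique (inj₁ e) (inj₁ e') = toℕ-injective (suc-injective (trans e (sym e')))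
⋖-predecessor-unique (inj₂ (_ , e)) (inj₂ (_ , e')) = toℕ-injective (suc-injective (trans e (sym e')))
⋖-predecessor-unique (inj₁ e) (inj₂ (c≡0 , _)) = contradiction (trans e c≡0) λ ()
⋖-predecessor-unique (inj₂ (c≡0 , _)) (inj₁ e) = contradiction (trans e c≡0) λ ()

⋖-successor-unique : ∀ {n} {c c' c'' : Fin n} → c ⋖ c' → c ⋖ c'' → c' ≡ c''
⋖-successor-unique (inj₁ e) (inj₁ e') = toℕ-injective (trans (sym e) e')
⋖-successor-unique (inj₂ (c'≡0 , _)) (inj₂ (c''≡0 , _)) = toℕ-injective (trans c'≡0 (sym c''≡0))
⋖-successor-unique {c' = c'} (inj₁ e) (inj₂ (_ , e')) =
  contradiction (trans (sym e) e') (<⇒≢ (toℕ<n c'))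
⋖-successor-unique {c'' = c''} (inj₂ (_ , e)) (inj₁ e') =
  contradiction (trans (sym e') e) (<⇒≢ (toℕ<n c''))

window : Kind → ∀ {n m} → VSet n m → Fin n → ℕ
window k D c = d k D (toℕ c) + d k D (suc (toℕ c)) + d k D (suc (suc (toℕ c)))

module _ {n m : ℕ} (D : VSet n m) where

  dcol-column : (c : Fin n) → dcol D (suc (toℕ c)) ≡ ∣ D c ∣
  dcol-column c with toℕ c <? n
  ... | yes c<n = cong (∣_∣ ∘ D) (fromℕ<-toℕ c c<n)
  ... | no  c≮n = contradiction (toℕ<n c) c≮n

  d-column : ∀ k (c : Fin n) → d k D (suc (toℕ c)) ≡ ∣ D c ∣
  d-column path  c = dcol-column c
  d-column cycle c with suc (toℕ c) ≟ suc n
  ... | yes e = contradiction (suc-injective e) (<⇒≢ (toℕ<n c))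
  ... | no  _ = dcol-column c

  d-cycle-0 : {c : Fin n} → suc (toℕ c) ≡ n → d cycle D 0 ≡ ∣ D c ∣
  d-cycle-0 {c} e = trans (cong (dcol D) (sym e)) (dcol-column c)

  d-cycle-n+1 : {c : Fin n} → toℕ c ≡ 0 → d cycle D (suc n) ≡ ∣ D c ∣
  d-cycle-n+1 {c} e with suc n ≟ suc n
  ... | yes _ = trans (cong (dcol D ∘ suc) (sym e)) (dcol-column c)
  ... | no  n+1≢n+1 = contradiction refl n+1≢n+1

  data WindowNeighbour (k : Kind) (c c' : Fin n) : Set where
    left  : c' ⋖ c → d k D (toℕ c) ≡ ∣ D c' ∣ → WindowNeighbour k c c'
    right : c ⋖ c' → d k D (suc (suc (toℕ c))) ≡ ∣ D c' ∣ → WindowNeighbour k c c'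

  pathAdj⇒windowNeighbour : ∀ k {c c' : Fin n} → PathAdj c' c → WindowNeighbour k c c'
  pathAdj⇒windowNeighbour k {c' = c'} (inj₁ e) =
    left (inj₁ e) (trans (cong (d k D) (sym e)) (d-column k c'))
  pathAdj⇒windowNeighbour k {c' = c'} (inj₂ e) =
    right (inj₁ e) (trans (cong (d k D ∘ suc) e) (d-column k c'))

  colAdj⇒windowNeighbour : ∀ k {c c' : Fin n} → ColAdj k c' c → WindowNeighbour k c c'
  colAdj⇒windowNeighbour path  adj = pathAdj⇒windowNeighbour path adj
  colAdj⇒windowNeighbour cycle (inj₁ adj) = pathAdj⇒windowNeighbour cycle adj
  colAdj⇒windowNeighbour cycle (inj₂ (inj₁ (c'≡0 , c+1≡n))) =
    right (inj₂ (c'≡0 , c+1≡n)) (trans (cong (d cycle D ∘ suc) c+1≡n) (d-cycle-n+1 c'≡0))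
  colAdj⇒windowNeighbour cycle (inj₂ (inj₂ (c≡0 , c'+1≡n))) =
    left (inj₂ (c≡0 , c'+1≡n)) (trans (cong (d cycle D) c≡0) (d-cycle-0 c'+1≡n))

data NearbyDominators (k : Kind) {n m} (D : VSet n m) (c : Fin n) : Set where
  column-two       : 2 ≤ ∣ D c ∣ → NearbyDominators k D c
  column-neighbour : ∀ {c'} → ColAdj k c' c → 1 ≤ ∣ D c ∣ → 1 ≤ ∣ D c' ∣ →
                     NearbyDominators k D c
  neighbour-two    : ∀ {c'} → ColAdj k c' c → 2 ≤ ∣ D c' ∣ → NearbyDominators k D c
  two-neighbours   : ∀ {c' c''} → ColAdj k c' c → ColAdj k c'' c → c' ≢ c'' →
                     1 ≤ ∣ D c' ∣ → 1 ≤ ∣ D c'' ∣ → NearbyDominators k D c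

module _ (k : Kind) {n m : ℕ} {D : VSet n m} (dom : Dominating k D) (c : Fin n) where

  absent⇒nearbyDominators : ∀ j → j ∉ D c → NearbyDominators k D c
  absent⇒nearbyDominators j j∉Dc with dom (c , j) j∉Dc
  ... | (c' , j') , j'∈Dc' , adj , _ with j' ∈? D c
  ...   | yes j'∈Dc = column-neighbour adj (x∈p⇒0<∣p∣ j'∈Dc) (x∈p⇒0<∣p∣ j'∈Dc')
  ...   | no  j'∉Dc with dom (c , j') j'∉Dc
  ...     | (c'' , j'') , j''∈Dc'' , adj' , j''≢j' with c' ≟ᶠ c''
  ...       | yes refl = neighbour-two adj (x∈p∧y∈p∧x≢y⇒1<∣p∣ j'∈Dc' j''∈Dc'' (j''≢j' ∘ sym))
  ...       | no  c'≢c'' = two-neighbours adj adj' c'≢c'' (x∈p⇒0<∣p∣ j'∈Dc') (x∈p⇒0<∣p∣ j''∈Dc'')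

  dominating⇒nearbyDominators : 2 ≤ m → NearbyDominators k D c
  dominating⇒nearbyDominators (s≤s (s≤s _)) with fzero ∈? D c | fsuc fzero ∈? D c
  ... | yes 0∈Dc | yes 1∈Dc = column-two (x∈p∧y∈p∧x≢y⇒1<∣p∣ 0∈Dc 1∈Dc λ ())
  ... | no  0∉Dc | _        = absent⇒nearbyDominators fzero 0∉Dc
  ... | yes _    | no 1∉Dc  = absent⇒nearbyDominators (fsuc fzero) 1∉Dc

module _ (k : Kind) {n m : ℕ} {D : VSet n m} {c : Fin n} where

  private
    slot : ∀ {x a b} → a ≡ b → x ≤ b → x ≤ a
    slot a≡b = subst (_ ≤_) (sym a≡b)

    centre : ∀ {x} → x ≤ ∣ D c ∣ → x ≤ d k D (suc (toℕ c))
    centre = slot (d-column D k c)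

    window-≥ : ∀ {x y z} → x ≤ d k D (toℕ c) → y ≤ d k D (suc (toℕ c)) →
               z ≤ d k D (suc (suc (toℕ c))) → x + y + z ≤ window k D c
    window-≥ hx hy hz = +-mono-≤ (+-mono-≤ hx hy) hz

  nearbyDominators⇒2≤window : NearbyDominators k D c → 2 ≤ window k D c
  nearbyDominators⇒2≤window (column-two h) = window-≥ z≤n (centre h) z≤n
  nearbyDominators⇒2≤window (column-neighbour adj hc hc') with colAdj⇒windowNeighbour D k adj
  ... | left  _ e = window-≥ (slot e hc') (centre hc) z≤n
  ... | right _ e = window-≥ z≤n (centre hc) (slot e hc')
  nearbyDominators⇒2≤window (neighbour-two adj h) with colAdj⇒windowNeighbour D k adj
  ... | left  _ e = window-≥ (slot e h) z≤n z≤n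
  ... | right _ e = window-≥ z≤n z≤n (slot e h)
  nearbyDominators⇒2≤window (two-neighbours adj adj' c'≢c'' h h')
    with colAdj⇒windowNeighbour D k adj | colAdj⇒windowNeighbour D k adj'
  ... | left  p _ | left  p' _ = contradiction (⋖-predecessor-unique p p') c'≢c''
  ... | right p _ | right p' _ = contradiction (⋖-successor-unique p p') c'≢c''
  ... | left  _ e | right _ e' = window-≥ (slot e h) z≤n (slot e' h')
  ... | right _ e | left  _ e' = window-≥ (slot e' h') z≤n (slot e h)

lemma3p1 : (k : Kind) (m n : ℕ) → m ≥ 3 → n ≥ 2 →
    (D : VSet n m) → Dominating k D →
    ∀ (i : ℕ) → 1 ≤ i → i ≤ n →
    d k D (i ∸ 1) + d k D i + d k D (suc i) ≥ 2
lemma3p1 k m n m≥3 _ D dom (suc i) _ i<n =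
  subst (λ t → 2 ≤ d k D t + d k D (suc t) + d k D (suc (suc t))) (toℕ-fromℕ< i<n)
    (nearbyDominators⇒2≤window k
      (dominating⇒nearbyDominators k dom (fromℕ< i<n) (≤-trans (n≤1+n 2) m≥3)))
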